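{- Let $t_{7_3}$ be the ternary tree pattern in which the root has three children, the left child $u$ of the root has three children, the left child of $u$ has three children, and all other vertices are leaves; let $t_{7_7}$ be the analogous pattern with "center" in place of "left" in both places (the center child $u$ of the root and the center child of $u$ are internal). Then $\mathrm{av}_{t_{7_3}}(n)=\mathrm{av}_{t_{7_7}}(n)$ for all $n\ge 0$, and $a=g_{t_{7_3}}(x)=g_{t_{7_7}}(x)$ satisfies $$x a^4 + x a^2 - a + x = 0.$$
   Context: A ternary tree is a rooted ordered tree in which every vertex has either $0$ children (a leaf) or exactly $3$ ordered children (left, center, right). A ternary tree $T$ contains a ternary tree pattern $t$ if there is a vertex $v$ of $T$ such that, placing the root of $t$ at $v$ and matching children in order, every internal vertex of $t$ corresponds to an internal vertex of $T$ (i.e. $t$ is a contiguous, rooted, ordered subtree of $T$); otherwise $T$ avoids $t$. $\mathrm{av}_t(n)$ is the number of ternary trees with $n$ leaves that avoid $t$ (the single-vertex tree counts as the unique tree with $1$ leaf), and $g_t(x)=\sum_{n\ge 0}\mathrm{av}_t(n)x^n$. -}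

module Defs where

open import Data.Nat using (ℕ; zero; suc; _+_; _∸_)
open import Data.Integer as ℤ using (ℤ)
open import Data.List using (List; length; map; upTo)
import Data.List as L
open import Data.List.Membership.Propositional using (_∈_)
open import Data.List.Relation.Unary.Unique.Propositional using (Unique)
open import Data.Product using (Σ; _×_)
open import Data.Sum using (_⊎_)
open import Data.Unit using (⊤)
open import Relation.Nullary using (¬_)
open import Relation.Binary.PropositionalEquality using (_≡_)
open import Function.Bundles using (_⇔_)

data Tree : Set where
  leaf : Tree
  node : Tree → Tree → Tree → Tree   -- left, center, right

leaves : Tree → ℕ
leaves leaf = 1
leaves (node l c r) = leaves l + leaves c + leaves r

data MatchesAtRoot : Tree → Tree → Set where
  m-leaf : ∀ {T} → MatchesAtRoot leaf T
  m-node : ∀ {a b c l m r} →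
           MatchesAtRoot a l → MatchesAtRoot b m → MatchesAtRoot c r →
           MatchesAtRoot (node a b c) (node l m r)

data Contains (t : Tree) : Tree → Set where
  here  : ∀ {T} → MatchesAtRoot t T → Contains t T
  inL   : ∀ {l m r} → Contains t l → Contains t (node l m r)
  inC   : ∀ {l m r} → Contains t m → Contains t (node l m r)
  inR   : ∀ {l m r} → Contains t r → Contains t (node l m r)

Avoids : Tree → Tree → Set
Avoids t T = ¬ Contains t T

AvoidersWithLeaves : Tree → ℕ → Tree → Set
AvoidersWithLeaves t n T = (leaves T ≡ n) × Avoids t T

HasCount : (Tree → Set) → ℕ → Set
HasCount P k = Σ (List Tree) λ xs →
  Unique xs × (∀ T → (T ∈ xs ⇔ P T)) × (length xs ≡ k)

AvCount : Tree → ℕ → ℕ → Set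
AvCount t n k = HasCount (AvoidersWithLeaves t n) k

t7₃ : Tree
t7₃ = node (node (node leaf leaf leaf) leaf leaf) leaf leaf

t7₇ : Tree
t7₇ = node leaf (node leaf (node leaf leaf leaf) leaf) leaf

FPS : Set
FPS = ℕ → ℤ

_⊕_ : FPS → FPS → FPS
(f ⊕ g) n = f n ℤ.+ g n

⊖_ : FPS → FPS
(⊖ f) n = ℤ.- f n

sumℤ : List ℤ → ℤ
sumℤ = L.foldr ℤ._+_ (ℤ.+ 0)

_⊗_ : FPS → FPS → FPS
(f ⊗ g) n = sumℤ (map (λ i → f i ℤ.* g (n ∸ i)) (upTo (suc n)))

X : FPS
X (suc zero) = ℤ.+ 1
X _ = ℤ.+ 0

zeroS : FPS
zeroS _ = ℤ.+ 0

series : (ℕ → ℕ) → FPS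
series a n = ℤ.+ (a n)

infixl 6 _⊕_
infixl 7 _⊗_

-- A ternary tree avoids t7₃ exactly when it is a leaf, node leaf a b, or
-- node (node leaf a b) c d with a, b, c, d avoiding t7₃: the left child of a
-- vertex may be internal only if its own left child is a leaf. Hence the
-- avoiders are generated by a = x + x a² + x a⁴. Exchanging the left and center
-- children at every vertex is a leaf-preserving involution sending t7₇ to t7₃,
-- so both patterns are avoided by equally many trees of each size.
-- The counts are certified by explicit duplicate-free lists of the avoiders
-- with n leaves, obtained by iterating the decomposition n + 1 times.

module Submission where

open import Defs
open import Data.Nat using (ℕ; zero; suc; _+_; _*_; _∸_; _≤_; _<_; s≤s)
open import Data.Nat.Properties
  using (m≤m+n; m≤n+m; m+n∸m≡n; m+[n∸m]≡n; m+n≤o⇒m≤o; ≤-trans; ≤-pred; n<1+n; +-comm)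
open import Data.Integer as ℤ using (ℤ; +_)
import Data.Integer.Properties as ℤ
open import Data.Integer.Tactic.RingSolver using (solve-∀)
open import Data.List using (List; []; _∷_; _++_; map; concatMap; cartesianProduct; upTo; length)
open import Data.List.Properties using (length-++; length-map; map-cong)
open import Data.List.Membership.Propositional using (_∈_; _∉_; find; lose)
open import Data.List.Membership.Propositional.Properties
  using (∈-map⁺; ∈-map⁻; ∈-++⁺ˡ; ∈-++⁺ʳ; ∈-++⁻; ∈-concatMap⁺; ∈-concatMap⁻;
         ∈-cartesianProduct⁺; ∈-cartesianProduct⁻; ∈-upTo⁺; ∈-upTo⁻)
open import Data.List.Membership.Propositional.Properties.WithK using (unique∧set⇒bag)
open import Data.List.Relation.Unary.Any using (here)
open import Data.List.Relation.Unary.All as All using (tabulate)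
import Data.List.Relation.Unary.All.Properties as AllP
import Data.List.Relation.Unary.AllPairs as AllPairs
import Data.List.Relation.Unary.AllPairs.Properties as AllPairsP
open import Data.List.Relation.Unary.Unique.Propositional using (Unique; []; _∷_)
import Data.List.Relation.Unary.Unique.Propositional.Properties as Unique
open import Data.List.Relation.Binary.Disjoint.Propositional using (Disjoint)
open import Data.List.Relation.Binary.BagAndSetEquality using (∼bag⇒↭)
open import Data.List.Relation.Binary.Permutation.Propositional.Properties using (↭-length)
open import Data.Product using (Σ; ∃; ∃₂; _×_; _,_; proj₁)
open import Data.Sum using (inj₁; inj₂)
open import Data.Empty using (⊥-elim)
open import Function using (_∘_)
open import Function.Bundles using (_⇔_; mk⇔)
import Function.Properties.Equivalence as ⇔
open import Relation.Binary.PropositionalEquality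
  using (_≡_; _≢_; _≗_; refl; sym; trans; cong; cong₂; subst; subst₂; module ≡-Reasoning)

m+n<o⇒m<o : ∀ m {n o} → m + n < o → m < o
m+n<o⇒m<o m = m+n≤o⇒m≤o (suc m)

m+n<o⇒n<o : ∀ m {n o} → m + n < o → n < o
m+n<o⇒n<o m {n} = ≤-trans (s≤s (m≤n+m n m))

hasCount-unique : ∀ {P k k′} → HasCount P k → HasCount P k′ → k ≡ k′
hasCount-unique (xs , xs! , xs⇔ , refl) (ys , ys! , ys⇔ , refl) =
  ↭-length (∼bag⇒↭ (unique∧set⇒bag xs! ys! (λ {T} → ⇔.trans (xs⇔ T) (⇔.sym (ys⇔ T)))))

hasCount-resp-⇔ : ∀ {P Q k} → (∀ T → P T ⇔ Q T) → HasCount P k → HasCount Q k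
hasCount-resp-⇔ P⇔Q (xs , xs! , xs⇔ , len) = xs , xs! , (λ T → ⇔.trans (xs⇔ T) (P⇔Q T)) , len

hasCount-∘-involution : ∀ {P k} (φ : Tree → Tree) → (∀ T → φ (φ T) ≡ T) →
                        HasCount P k → HasCount (P ∘ φ) k
hasCount-∘-involution φ φφ≡id (xs , xs! , xs⇔ , len) =
  map φ xs , Unique.map⁺ φ-injective xs! , (λ T → ⇔.trans ∈-map-φ (xs⇔ (φ T))) ,
  trans (length-map φ xs) len
  where
  φ-injective : ∀ {S T} → φ S ≡ φ T → S ≡ T
  φ-injective {S} {T} eq = trans (sym (φφ≡id S)) (trans (cong φ eq) (φφ≡id T))

  ∈-map-φ : ∀ {T} → T ∈ map φ xs ⇔ φ T ∈ xs
  ∈-map-φ {T} = mk⇔ to (λ φT∈xs → subst (_∈ map φ xs) (φφ≡id T) (∈-map⁺ φ φT∈xs))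
    where
    to : T ∈ map φ xs → φ T ∈ xs
    to T∈ with ∈-map⁻ φ T∈
    ... | S , S∈xs , refl = subst (_∈ xs) (sym (φφ≡id S)) S∈xs

swapLC : Tree → Tree
swapLC leaf         = leaf
swapLC (node l c r) = node (swapLC c) (swapLC l) (swapLC r)

swapLC-involutive : ∀ T → swapLC (swapLC T) ≡ T
swapLC-involutive leaf = refl
swapLC-involutive (node l c r)
  rewrite swapLC-involutive l | swapLC-involutive c | swapLC-involutive r = refl

leaves-swapLC : ∀ T → leaves (swapLC T) ≡ leaves T
leaves-swapLC leaf = refl
leaves-swapLC (node l c r) = begin
  leaves (swapLC c) + leaves (swapLC l) + leaves (swapLC r)
    ≡⟨ cong₂ (λ x y → x + y + leaves (swapLC r)) (leaves-swapLC c) (leaves-swapLC l) ⟩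
  leaves c + leaves l + leaves (swapLC r)
    ≡⟨ cong₂ _+_ (+-comm (leaves c) (leaves l)) (leaves-swapLC r) ⟩
  leaves l + leaves c + leaves r ∎
  where open ≡-Reasoning

matchesAtRoot-swapLC : ∀ {s T} → MatchesAtRoot s T → MatchesAtRoot (swapLC s) (swapLC T)
matchesAtRoot-swapLC m-leaf           = m-leaf
matchesAtRoot-swapLC (m-node ml mc mr) =
  m-node (matchesAtRoot-swapLC mc) (matchesAtRoot-swapLC ml) (matchesAtRoot-swapLC mr)

contains-swapLC : ∀ {s T} → Contains s T → Contains (swapLC s) (swapLC T)
contains-swapLC (here m) = here (matchesAtRoot-swapLC m)
contains-swapLC (inL c)  = inC (contains-swapLC c)
contains-swapLC (inC c)  = inL (contains-swapLC c)
contains-swapLC (inR c)  = inR (contains-swapLC c)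

avoidersWithLeaves-swapLC : ∀ {s n T} →
  AvoidersWithLeaves s n T ⇔ AvoidersWithLeaves (swapLC s) n (swapLC T)
avoidersWithLeaves-swapLC {s} {n} {T} = mk⇔
  (λ (T≡n , av) → trans (leaves-swapLC T) T≡n ,
                  λ c → av (subst₂ Contains (swapLC-involutive s) (swapLC-involutive T) (contains-swapLC c)))
  (λ (φT≡n , av) → trans (sym (leaves-swapLC T)) φT≡n , av ∘ contains-swapLC)

avCount-swapLC : ∀ {s n k} → AvCount (swapLC s) n k → AvCount s n k
avCount-swapLC count =
  hasCount-resp-⇔ (λ _ → ⇔.sym avoidersWithLeaves-swapLC)
    (hasCount-∘-involution swapLC swapLC-involutive count)

Graded : {A : Set} → (ℕ → List A) → Set
Graded F = ∀ {x i j} → x ∈ F i → x ∈ F j → i ≡ j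

infixl 7 _⋆_

_⋆_ : {A B : Set} → (ℕ → List A) → (ℕ → List B) → ℕ → List (A × B)
(F ⋆ G) n = concatMap (λ i → cartesianProduct (F i) (G (n ∸ i))) (upTo (suc n))

module _ {A B : Set} (F : ℕ → List A) (G : ℕ → List B) where

  ∈-⋆⁺ : ∀ {x y i j} → x ∈ F i → y ∈ G j → (x , y) ∈ (F ⋆ G) (i + j)
  ∈-⋆⁺ {x} {y} {i} {j} x∈ y∈ =
    ∈-concatMap⁺ (λ k → cartesianProduct (F k) (G (i + j ∸ k))) (lose (∈-upTo⁺ (s≤s (m≤m+n i j)))
      (subst (λ j′ → (x , y) ∈ cartesianProduct (F i) (G j′)) (sym (m+n∸m≡n i j))
        (∈-cartesianProduct⁺ x∈ y∈)))

  ∈-⋆⁻ : ∀ {x y n} → (x , y) ∈ (F ⋆ G) n → ∃₂ λ i j → x ∈ F i × y ∈ G j × i + j ≡ n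
  ∈-⋆⁻ {n = n} xy∈ with find (∈-concatMap⁻ (λ i → cartesianProduct (F i) (G (n ∸ i))) xy∈)
  ... | i , i∈ , xy∈′ with ∈-cartesianProduct⁻ (F i) (G (n ∸ i)) xy∈′
  ... | x∈ , y∈ = i , n ∸ i , x∈ , y∈ , m+[n∸m]≡n (≤-pred (∈-upTo⁻ i∈))

  ⋆-graded : Graded F → Graded G → Graded (F ⋆ G)
  ⋆-graded gF gG p q with ∈-⋆⁻ p | ∈-⋆⁻ q
  ... | _ , _ , x∈ , y∈ , refl | _ , _ , x∈′ , y∈′ , refl = cong₂ _+_ (gF x∈ x∈′) (gG y∈ y∈′)

  ⋆-unique : (∀ i → Unique (F i)) → (∀ j → Unique (G j)) → Graded F → ∀ n → Unique ((F ⋆ G) n)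
  ⋆-unique uF uG gF n = Unique.concat⁺
    (AllP.map⁺ (tabulate λ {i} _ → Unique.cartesianProduct⁺ (uF i) (uG (n ∸ i))))
    (AllPairsP.map⁺ (AllPairs.map disjoint (Unique.upTo⁺ (suc n))))
    where
    disjoint : ∀ {i i′} → i ≢ i′ →
               Disjoint (cartesianProduct (F i) (G (n ∸ i))) (cartesianProduct (F i′) (G (n ∸ i′)))
    disjoint i≢i′ (p , q) =
      i≢i′ (gF (proj₁ (∈-cartesianProduct⁻ (F _) _ p)) (proj₁ (∈-cartesianProduct⁻ (F _) _ q)))

gf : {A : Set} → (ℕ → List A) → FPS
gf F n = + length (F n)

⊗-congˡ : ∀ {F F′} G → F ≗ F′ → (F ⊗ G) ≗ (F′ ⊗ G)
⊗-congˡ G F≗F′ n = cong sumℤ (map-cong (λ i → cong (ℤ._* G (n ∸ i)) (F≗F′ i)) (upTo (suc n)))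

gf-++ : ∀ {A : Set} (F G : ℕ → List A) n → gf (λ m → F m ++ G m) n ≡ (gf F ⊕ gf G) n
gf-++ F G n = trans (cong +_ (length-++ (F n))) (ℤ.pos-+ (length (F n)) (length (G n)))

+length-concatMap : ∀ {A B : Set} (h : A → List B) xs →
                    + length (concatMap h xs) ≡ sumℤ (map (λ x → + length (h x)) xs)
+length-concatMap h []       = refl
+length-concatMap h (x ∷ xs) = begin
  + length (h x ++ concatMap h xs)            ≡⟨ cong +_ (length-++ (h x)) ⟩
  + (length (h x) + length (concatMap h xs))  ≡⟨ ℤ.pos-+ (length (h x)) _ ⟩
  + length (h x) ℤ.+ + length (concatMap h xs) ≡⟨ cong (ℤ._+_ (+ length (h x))) (+length-concatMap h xs) ⟩
  sumℤ (map (λ x → + length (h x)) (x ∷ xs))  ∎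
  where open ≡-Reasoning

length-cartesianProduct : ∀ {A B : Set} (xs : List A) (ys : List B) →
                          length (cartesianProduct xs ys) ≡ length xs * length ys
length-cartesianProduct []       ys = refl
length-cartesianProduct (x ∷ xs) ys =
  trans (length-++ (map (x ,_) ys)) (cong₂ _+_ (length-map (x ,_) ys) (length-cartesianProduct xs ys))

gf-⋆ : ∀ {A B : Set} (F : ℕ → List A) (G : ℕ → List B) → gf (F ⋆ G) ≗ gf F ⊗ gf G
gf-⋆ F G n =
  trans (+length-concatMap (λ i → cartesianProduct (F i) (G (n ∸ i))) (upTo (suc n)))
        (cong sumℤ (map-cong +length-product (upTo (suc n))))
  where
  +length-product : ∀ i → + length (cartesianProduct (F i) (G (n ∸ i))) ≡ gf F i ℤ.* gf G (n ∸ i)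
  +length-product i = trans (cong +_ (length-cartesianProduct (F i) (G (n ∸ i))))
                            (ℤ.pos-* (length (F i)) (length (G (n ∸ i))))

Family : Set
Family = ℕ → List Tree

LeafGraded : Family → Set
LeafGraded F = ∀ {n T} → T ∈ F n → leaves T ≡ n

leafGraded⇒graded : ∀ {F} → LeafGraded F → Graded F
leafGraded⇒graded gF T∈Fi T∈Fj = trans (sym (gF T∈Fi)) (gF T∈Fj)

leafOnly : Family
leafOnly (suc zero) = leaf ∷ []
leafOnly _          = []

∈-leafOnly : ∀ {n T} → T ∈ leafOnly n → T ≡ leaf × n ≡ 1
∈-leafOnly {suc zero} (here refl) = refl , refl

leafOnly-unique : ∀ n → Unique (leafOnly n)
leafOnly-unique zero          = []
leafOnly-unique (suc zero)    = All.[] ∷ []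
leafOnly-unique (suc (suc n)) = []

gf-leafOnly : gf leafOnly ≗ X
gf-leafOnly zero          = refl
gf-leafOnly (suc zero)    = refl
gf-leafOnly (suc (suc n)) = refl

infixl 5 _∪_

_∪_ : Family → Family → Family
(F ∪ G) n = F n ++ G n

uncurriedNode : (Tree × Tree) × Tree → Tree
uncurriedNode ((l , c) , r) = node l c r

uncurriedNode-injective : ∀ {p q} → uncurriedNode p ≡ uncurriedNode q → p ≡ q
uncurriedNode-injective {(_ , _) , _} {(_ , _) , _} refl = refl

-- Opaque so that nodes F G H n stays rigid and F, G, H, n are inferred by unification.
opaque
  nodes : Family → Family → Family → Family
  nodes F G H n = map uncurriedNode ((F ⋆ G ⋆ H) n)

data NodeIn (F G H : Family) : ℕ → Tree → Set where
  node∈ : ∀ {i j k l c r} → l ∈ F i → c ∈ G j → r ∈ H k → NodeIn F G H (i + j + k) (node l c r)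

opaque
  unfolding nodes

  ∈-nodes⁺ : ∀ {F G H n T} → NodeIn F G H n T → T ∈ nodes F G H n
  ∈-nodes⁺ {F} {G} {H} (node∈ l∈ c∈ r∈) =
    ∈-map⁺ uncurriedNode (∈-⋆⁺ (F ⋆ G) H (∈-⋆⁺ F G l∈ c∈) r∈)

  ∈-nodes⁻ : ∀ {F G H n T} → T ∈ nodes F G H n → NodeIn F G H n T
  ∈-nodes⁻ {F} {G} {H} T∈ with ∈-map⁻ uncurriedNode T∈
  ... | ((l , c) , r) , lcr∈ , refl with ∈-⋆⁻ (F ⋆ G) H lcr∈
  ... | _ , _ , lc∈ , r∈ , refl with ∈-⋆⁻ F G lc∈
  ... | _ , _ , l∈ , c∈ , refl = node∈ l∈ c∈ r∈

  nodes-unique : ∀ {F G H} → LeafGraded F → LeafGraded G →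
                 (∀ i → Unique (F i)) → (∀ j → Unique (G j)) → (∀ k → Unique (H k)) →
                 ∀ n → Unique (nodes F G H n)
  nodes-unique {F} {G} {H} gF gG uF uG uH n =
    Unique.map⁺ uncurriedNode-injective
      (⋆-unique (F ⋆ G) H (⋆-unique F G uF uG (leafGraded⇒graded gF)) uH
                (⋆-graded F G (leafGraded⇒graded gF) (leafGraded⇒graded gG)) n)

  gf-nodes : ∀ {F G H} → gf (nodes F G H) ≗ gf F ⊗ gf G ⊗ gf H
  gf-nodes {F} {G} {H} n = begin
    + length (map uncurriedNode ((F ⋆ G ⋆ H) n)) ≡⟨ cong +_ (length-map uncurriedNode ((F ⋆ G ⋆ H) n)) ⟩
    gf (F ⋆ G ⋆ H) n                             ≡⟨ gf-⋆ (F ⋆ G) H n ⟩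
    (gf (F ⋆ G) ⊗ gf H) n                        ≡⟨ ⊗-congˡ (gf H) (gf-⋆ F G) n ⟩
    (gf F ⊗ gf G ⊗ gf H) n                       ∎
    where open ≡-Reasoning

module _ {F G H : Family} where

  ∈-nodes⁻ˡ : ∀ {n l c r} → node l c r ∈ nodes F G H n → ∃ λ i → l ∈ F i
  ∈-nodes⁻ˡ T∈ with ∈-nodes⁻ T∈
  ... | node∈ l∈ _ _ = _ , l∈

  leaf∉nodes : ∀ {n} → leaf ∉ nodes F G H n
  leaf∉nodes leaf∈ with ∈-nodes⁻ leaf∈
  ... | ()

  nodes-leafGraded : LeafGraded F → LeafGraded G → LeafGraded H → LeafGraded (nodes F G H)
  nodes-leafGraded gF gG gH T∈ with ∈-nodes⁻ T∈
  ... | node∈ l∈ c∈ r∈ = cong₂ _+_ (cong₂ _+_ (gF l∈) (gG c∈)) (gH r∈)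

avoids-leaf : Avoids t7₃ leaf
avoids-leaf (here ())

avoids-node-leaf : ∀ {a b} → Avoids t7₃ a → Avoids t7₃ b → Avoids t7₃ (node leaf a b)
avoids-node-leaf avA avB (here (m-node () _ _))
avoids-node-leaf avA avB (inL (here ()))
avoids-node-leaf avA avB (inC p) = avA p
avoids-node-leaf avA avB (inR p) = avB p

avoids-node-node-leaf : ∀ {a b c d} → Avoids t7₃ a → Avoids t7₃ b → Avoids t7₃ c → Avoids t7₃ d →
                        Avoids t7₃ (node (node leaf a b) c d)
avoids-node-node-leaf avA avB avC avD (here (m-node (m-node () _ _) _ _))
avoids-node-node-leaf avA avB avC avD (inL p) = avoids-node-leaf avA avB p
avoids-node-node-leaf avA avB avC avD (inC p) = avC p
avoids-node-node-leaf avA avB avC avD (inR p) = avD p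

Sound : Family → Set
Sound F = ∀ {n T} → T ∈ F n → AvoidersWithLeaves t7₃ n T

CompleteBelow : ℕ → Family → Set
CompleteBelow k F = ∀ {n T} → n < k → AvoidersWithLeaves t7₃ n T → T ∈ F n

leftLeaf : Family → Family
leftLeaf F = nodes leafOnly F F

leftLeftLeaf : Family → Family
leftLeftLeaf F = nodes (leftLeaf F) F F

step : Family → Family
step F = leafOnly ∪ leftLeaf F ∪ leftLeftLeaf F

∪-sound : ∀ {F G} → Sound F → Sound G → Sound (F ∪ G)
∪-sound {F} sF sG {n} T∈ with ∈-++⁻ (F n) T∈
... | inj₁ T∈F = sF T∈F
... | inj₂ T∈G = sG T∈G

leafOnly-sound : Sound leafOnly
leafOnly-sound T∈ with ∈-leafOnly T∈
... | refl , refl = refl , avoids-leaf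

leftLeaf-sound : ∀ {F} → Sound F → Sound (leftLeaf F)
leftLeaf-sound sF T∈ with ∈-nodes⁻ T∈
... | node∈ l∈ c∈ r∈ with ∈-leafOnly l∈ | sF c∈ | sF r∈
... | refl , refl | refl , avC | refl , avR = refl , avoids-node-leaf avC avR

leftLeftLeaf-sound : ∀ {F} → Sound F → Sound (leftLeftLeaf F)
leftLeftLeaf-sound sF T∈ with ∈-nodes⁻ T∈
... | node∈ l∈ c∈ r∈ with ∈-nodes⁻ l∈ | sF c∈ | sF r∈
... | node∈ x∈ a∈ b∈ | refl , avC | refl , avD with ∈-leafOnly x∈ | sF a∈ | sF b∈
... | refl , refl | refl , avA | refl , avB = refl , avoids-node-node-leaf avA avB avC avD

step-sound : ∀ {F} → Sound F → Sound (step F)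
step-sound sF = ∪-sound (∪-sound leafOnly-sound (leftLeaf-sound sF)) (leftLeftLeaf-sound sF)

leafOnly⊆step : ∀ {F n T} → T ∈ leafOnly n → T ∈ step F n
leafOnly⊆step = ∈-++⁺ˡ ∘ ∈-++⁺ˡ

leftLeaf⊆step : ∀ {F n T} → T ∈ leftLeaf F n → T ∈ step F n
leftLeaf⊆step {n = n} = ∈-++⁺ˡ ∘ ∈-++⁺ʳ (leafOnly n)

leftLeftLeaf⊆step : ∀ {F n T} → T ∈ leftLeftLeaf F n → T ∈ step F n
leftLeftLeaf⊆step {F} {n} = ∈-++⁺ʳ ((leafOnly ∪ leftLeaf F) n)

step-complete : ∀ {k F} → CompleteBelow k F → CompleteBelow (suc k) (step F)
step-complete cF {T = leaf} _ (refl , _) = leafOnly⊆step (here refl)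
step-complete cF {T = node leaf a b} (s≤s ab<k) (refl , av) =
  leftLeaf⊆step (∈-nodes⁺ (node∈ (here refl)
    (cF (m+n<o⇒m<o (leaves a) ab<k) (refl , av ∘ inC))
    (cF (m+n<o⇒n<o (leaves a) ab<k) (refl , av ∘ inR))))
step-complete {k} cF {T = node (node leaf a b) c d} (s≤s abcd<k) (refl , av) =
  leftLeftLeaf⊆step (∈-nodes⁺ (node∈
    (∈-nodes⁺ (node∈ (here refl)
      (cF (m+n<o⇒m<o (leaves a) ab<k) (refl , av ∘ inL ∘ inC))
      (cF (m+n<o⇒n<o (leaves a) ab<k) (refl , av ∘ inL ∘ inR))))
    (cF (m+n<o⇒n<o (leaves a + leaves b) abc<k) (refl , av ∘ inC))
    (cF (m+n<o⇒n<o (leaves a + leaves b + leaves c) abcd<k) (refl , av ∘ inR))))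
  where
  abc<k : leaves a + leaves b + leaves c < k
  abc<k = m+n<o⇒m<o (leaves a + leaves b + leaves c) abcd<k
  ab<k : leaves a + leaves b < k
  ab<k = m+n<o⇒m<o (leaves a + leaves b) abc<k
step-complete cF {T = node (node (node _ _ _) _ _) _ _} _ (_ , av) =
  ⊥-elim (av (here (m-node (m-node (m-node m-leaf m-leaf m-leaf) m-leaf m-leaf) m-leaf m-leaf)))

leafOnly-leafGraded : LeafGraded leafOnly
leafOnly-leafGraded T∈ with ∈-leafOnly T∈
... | refl , refl = refl

leafOnly-disjoint-nodes : ∀ {F G H n} → Disjoint (leafOnly n) (nodes F G H n)
leafOnly-disjoint-nodes (T∈ , T∈′) with ∈-leafOnly T∈
... | refl , _ = leaf∉nodes T∈′

leftLeaf-disjoint-leftLeftLeaf : ∀ {F n} → Disjoint (leftLeaf F n) (leftLeftLeaf F n)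
leftLeaf-disjoint-leftLeftLeaf {v = leaf} (_ , leaf∈) = leaf∉nodes leaf∈
leftLeaf-disjoint-leftLeftLeaf {v = node _ _ _} (T∈ , T∈′)
  with ∈-nodes⁻ˡ T∈ | ∈-nodes⁻ˡ T∈′
... | _ , l∈leafOnly | _ , l∈leftLeaf with ∈-leafOnly l∈leafOnly
...   | refl , _ = leaf∉nodes l∈leftLeaf

step-unique : ∀ {F} → Sound F → (∀ n → Unique (F n)) → ∀ n → Unique (step F n)
step-unique {F} sF uF n =
  Unique.++⁺ (Unique.++⁺ (leafOnly-unique n) (leftLeaf-unique n) leafOnly-disjoint-nodes)
             (nodes-unique (nodes-leafGraded leafOnly-leafGraded gF gF) gF leftLeaf-unique uF uF n)
             shallow-disjoint-leftLeftLeaf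
  where
  gF : LeafGraded F
  gF = proj₁ ∘ sF

  leftLeaf-unique : ∀ i → Unique (leftLeaf F i)
  leftLeaf-unique = nodes-unique leafOnly-leafGraded gF leafOnly-unique uF uF

  shallow-disjoint-leftLeftLeaf : Disjoint ((leafOnly ∪ leftLeaf F) n) (leftLeftLeaf F n)
  shallow-disjoint-leftLeftLeaf (T∈ , T∈′) with ∈-++⁻ (leafOnly n) T∈
  ... | inj₁ T∈leafOnly = leafOnly-disjoint-nodes (T∈leafOnly , T∈′)
  ... | inj₂ T∈leftLeaf = leftLeaf-disjoint-leftLeftLeaf (T∈leftLeaf , T∈′)

approx : ℕ → Family
approx zero    n = []
approx (suc k) n = step (approx k) n

approx-sound : ∀ k → Sound (approx k)
approx-sound zero    ()
approx-sound (suc k) = step-sound (approx-sound k)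

approx-complete : ∀ k → CompleteBelow k (approx k)
approx-complete zero    ()
approx-complete (suc k) = step-complete (approx-complete k)

approx-unique : ∀ k n → Unique (approx k n)
approx-unique zero    n = []
approx-unique (suc k) = step-unique (approx-sound k) (approx-unique k)

avoiders : Family
avoiders n = approx (suc n) n

avoiders-sound : Sound avoiders
avoiders-sound {n} = approx-sound (suc n)

avoiders-complete : ∀ {k} → CompleteBelow k avoiders
avoiders-complete {n = n} _ = approx-complete (suc n) (n<1+n n)

avoiders-unique : ∀ n → Unique (avoiders n)
avoiders-unique n = approx-unique (suc n) n

avCount-length : ∀ {F n} → Sound F → CompleteBelow (suc n) F → Unique (F n) →
                 AvCount t7₃ n (length (F n))
avCount-length {F} {n} sF cF uF = F n , uF , (λ _ → mk⇔ sF (cF (n<1+n n))) , refl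

avCount-avoiders : ∀ n → AvCount t7₃ n (length (avoiders n))
avCount-avoiders n = avCount-length avoiders-sound avoiders-complete (avoiders-unique n)

gf-avoiders : gf avoiders ≗ gf (step avoiders)
gf-avoiders n = cong +_ (hasCount-unique (avCount-avoiders n)
  (avCount-length (step-sound avoiders-sound) (step-complete avoiders-complete)
                  (step-unique avoiders-sound avoiders-unique n)))

module _ (F : Family) where

  private
    a : FPS
    a = gf F

  gf-leftLeaf : gf (leftLeaf F) ≗ X ⊗ a ⊗ a
  gf-leftLeaf n = trans (gf-nodes n) (⊗-congˡ a (⊗-congˡ a gf-leafOnly) n)

  gf-leftLeftLeaf : gf (leftLeftLeaf F) ≗ X ⊗ a ⊗ a ⊗ a ⊗ a
  gf-leftLeftLeaf n = trans (gf-nodes n) (⊗-congˡ a (⊗-congˡ a gf-leftLeaf) n)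

  gf-step : gf (step F) ≗ X ⊕ X ⊗ a ⊗ a ⊕ X ⊗ a ⊗ a ⊗ a ⊗ a
  gf-step n = begin
    gf (step F) n
      ≡⟨ gf-++ (leafOnly ∪ leftLeaf F) (leftLeftLeaf F) n ⟩
    gf (leafOnly ∪ leftLeaf F) n ℤ.+ gf (leftLeftLeaf F) n
      ≡⟨ cong₂ ℤ._+_ (gf-++ leafOnly (leftLeaf F) n) (gf-leftLeftLeaf n) ⟩
    gf leafOnly n ℤ.+ gf (leftLeaf F) n ℤ.+ (X ⊗ a ⊗ a ⊗ a ⊗ a) n
      ≡⟨ cong₂ (λ x y → x ℤ.+ y ℤ.+ (X ⊗ a ⊗ a ⊗ a ⊗ a) n) (gf-leafOnly n) (gf-leftLeaf n) ⟩
    (X ⊕ X ⊗ a ⊗ a ⊕ X ⊗ a ⊗ a ⊗ a ⊗ a) n ∎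
    where open ≡-Reasoning

p+q-[x+q+p]+x≡0 : ∀ x q p → p ℤ.+ q ℤ.+ ℤ.- (x ℤ.+ q ℤ.+ p) ℤ.+ x ≡ + 0
p+q-[x+q+p]+x≡0 = solve-∀

functional-equation : let a = gf avoiders in
                      ∀ n → (X ⊗ a ⊗ a ⊗ a ⊗ a ⊕ X ⊗ a ⊗ a ⊕ ⊖ a ⊕ X) n ≡ zeroS n
functional-equation n =
  trans (cong (λ z → p ℤ.+ q ℤ.+ ℤ.- z ℤ.+ X n) (trans (gf-avoiders n) (gf-step avoiders n)))
        (p+q-[x+q+p]+x≡0 (X n) q p)
  where
  a : FPS
  a = gf avoiders
  p q : ℤ
  p = (X ⊗ a ⊗ a ⊗ a ⊗ a) n
  q = (X ⊗ a ⊗ a) n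

mainTheorem5 : Σ (ℕ → ℕ) λ av →
    (∀ n → AvCount t7₃ n (av n))
  × (∀ n → AvCount t7₇ n (av n))
  × (let a = series av in
     ∀ n → (X ⊗ a ⊗ a ⊗ a ⊗ a ⊕ X ⊗ a ⊗ a ⊕ ⊖ a ⊕ X) n ≡ zeroS n)
-- swapLC t7₇ reduces to t7₃, so avCount-swapLC turns counts for t7₃ into counts for t7₇.
mainTheorem5 = length ∘ avoiders , avCount-avoiders , avCount-swapLC ∘ avCount-avoiders , functional-equation
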